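{- $|\mathcal{P}_n(132,312)| = 2n-2$ for all $n\ge 2$, and $|\mathcal{P}_n(132,4123)| = F_{n+4}-2n-2$ for all $n \ge 0$.
   Context: $S_n$ is the set of permutations of $\{1,\dots,n\}$ in one-line notation; $S_0$ contains only the empty permutation. A permutation avoids a pattern $\sigma\in S_k$ if it has no subsequence of length $k$ whose entries are in the same relative order as $\sigma$. $\mathcal{P}_n(132,\tau)$ is the set of permutations in $S_n$ avoiding each of $132$, $2341$, $3241$ and $\tau$ (equivalently, the two-stack sortable permutations avoiding $132$ and $\tau$). The Fibonacci numbers are $F_0=0$, $F_1=1$, $F_n=F_{n-1}+F_{n-2}$ for $n\ge 2$. -}

module Defs where

open import Data.Nat using (ℕ; zero; suc; _+_)
open import Data.Fin using (Fin; _<_)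
open import Data.Vec using (Vec; lookup; []; _∷_)
open import Data.List using (List)
open import Data.List.Membership.Propositional using (_∈_)
open import Data.List.Relation.Unary.Unique.Propositional using (Unique)
open import Data.Product using (Σ; _×_; ∃)
open import Function.Bundles using (_⇔_)
open import Relation.Binary.PropositionalEquality using (_≡_)
open import Relation.Nullary using (¬_)
open import Data.Fin.Patterns

-- A permutation of {1,…,n} in one-line notation, values shifted to {0,…,n-1}:
-- a vector of length n whose entries are pairwise distinct (hence a bijection).
IsPerm : {n : ℕ} → Vec (Fin n) n → Set
IsPerm {n} v = ∀ (i j : Fin n) → lookup v i ≡ lookup v j → i ≡ j

Contains : {n k : ℕ} → Vec (Fin n) n → Vec (Fin k) k → Set
Contains {n} {k} v σ =
  Σ (Fin k → Fin n) λ f →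
    (∀ (i j : Fin k) → i < j → f i < f j) ×
    (∀ (i j : Fin k) → (lookup σ i < lookup σ j) ⇔ (lookup v (f i) < lookup v (f j)))

Avoids : {n k : ℕ} → Vec (Fin n) n → Vec (Fin k) k → Set
Avoids v σ = ¬ Contains v σ

-- Patterns in one-line notation (entries shifted down by 1).
p132 : Vec (Fin 3) 3
p132 = 0F ∷ 2F ∷ 1F ∷ []

p312 : Vec (Fin 3) 3
p312 = 2F ∷ 0F ∷ 1F ∷ []

p2341 : Vec (Fin 4) 4
p2341 = 1F ∷ 2F ∷ 3F ∷ 0F ∷ []

p3241 : Vec (Fin 4) 4
p3241 = 2F ∷ 1F ∷ 3F ∷ 0F ∷ []

p4123 : Vec (Fin 4) 4
p4123 = 3F ∷ 0F ∷ 1F ∷ 2F ∷ []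

InP : {n k : ℕ} → Vec (Fin k) k → Vec (Fin n) n → Set
InP τ v = IsPerm v × Avoids v p132 × Avoids v p2341 × Avoids v p3241 × Avoids v τ

HasCard : {n : ℕ} → (Vec (Fin n) n → Set) → ℕ → Set
HasCard {n} S m =
  Σ (List (Vec (Fin n) n)) λ xs →
    (Data.List.length xs ≡ m) × Unique xs × (∀ v → (v ∈ xs) ⇔ S v)

fib : ℕ → ℕ
fib zero = 0
fib (suc zero) = 1
fib (suc (suc n)) = fib (suc n) + fib n

{-# OPTIONS --safe #-}
module Submission where

-- The permutations avoiding 132, 2341 and 3241 are the two-stack-sortable 132-avoiders.
-- In a 132-avoider every entry before the maximum n exceeds every entry after it, and
-- avoiding 2341 and 3241 then leaves n only three places: such a permutation of length n
-- is α n, n β or (n-1) n β, where α and the nonempty β are again two-stack-sortable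
-- 132-avoiders. A further pattern τ constrains α and β separately. For τ = 312, α must
-- avoid 312 and β must avoid 12, i.e. be decreasing, so the count grows by 2 at each
-- step. For τ = 4123, α must avoid 4123 and β must avoid 123; the 123-avoiders (whose α
-- must avoid 12) satisfy q n = 1 + q (n-1) + q (n-2), hence q n = F (n+2) - 1, and then
-- p n = p (n-1) + q (n-1) + q (n-2) gives p n = F (n+4) - 2n - 2.

open import Defs
open import Data.Empty using (⊥; ⊥-elim)
open import Data.Fin as Fin using (Fin; toℕ; fromℕ; fromℕ<; inject₁; punchOut)
open import Data.Fin.Patterns
import Data.Fin.Properties as Finₚ
open import Data.List as List using (_++_)
open import Data.List.Membership.Propositional using (_∈_)
open import Data.List.Membership.Propositional.Properties
  using (∈-map⁺; ∈-map⁻; ∈-++⁺ˡ; ∈-++⁺ʳ; ∈-++⁻)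
open import Data.List.Properties using (length-map; length-++)
import Data.List.Relation.Unary.All as All
import Data.List.Relation.Unary.AllPairs as AllPairs
open import Data.List.Relation.Unary.Any using (here; there)
import Data.List.Relation.Unary.Unique.Propositional.Properties as Uniqueₚ
open import Data.Nat using (ℕ; zero; suc; _+_; _*_; _∸_; _≤_; _<_; z≤n; s≤s; z<s; s<s)
open import Data.Nat.Properties
open import Data.Nat.Tactic.RingSolver using (solve-∀)
open import Data.Product using (_×_; _,_; proj₁; proj₂; ∃)
open import Data.Product.Function.NonDependent.Propositional using (_×-⇔_)
open import Data.Sum as Sum using (_⊎_; inj₁; inj₂; [_,_]′)
open import Data.Vec as Vec using (Vec; []; _∷_; lookup; _∷ʳ_; initLast)
open import Data.Vec.Properties using (lookup-map)
open import Data.Vec.Relation.Unary.All as AllV using ([]; _∷_)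
import Data.Vec.Relation.Unary.All.Properties as AllVₚ
open import Data.Vec.Relation.Unary.Linked using (Linked; []; [-]; _∷_)
import Data.Vec.Relation.Unary.Linked.Properties as Linkedₚ
open import Function.Base using (_∘_)
open import Function.Bundles using (_⇔_; mk⇔; Equivalence)
open import Function.Construct.Composition using (_⇔-∘_)
open import Function.Related.TypeIsomorphisms using (¬-cong-⇔)
open import Relation.Binary.Definitions using (tri<; tri≈; tri>)
open import Relation.Binary.PropositionalEquality
open import Relation.Nullary using (¬_; yes; no)

open Equivalence using (to; from)

-- Words and their entries

Word : ℕ → Set
Word n = Vec (Fin n) n

infixl 9 _!_

-- Entries are read as natural numbers at natural-number positions, with the junk
-- value 0 outside the vector; this avoids all casts between different Fin types.
_!_ : ∀ {n k} → Vec (Fin n) k → ℕ → ℕ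
[]       ! _     = 0
(x ∷ _)  ! zero  = toℕ x
(_ ∷ xs) ! suc i = xs ! i

!-lookup : ∀ {n k} (v : Vec (Fin n) k) (p : Fin k) → v ! toℕ p ≡ toℕ (lookup v p)
!-lookup (x ∷ xs) Fin.zero    = refl
!-lookup (x ∷ xs) (Fin.suc p) = !-lookup xs p

!-fromℕ< : ∀ {n k i} (v : Vec (Fin n) k) (i<k : i < k) → toℕ (lookup v (fromℕ< i<k)) ≡ v ! i
!-fromℕ< v i<k = trans (sym (!-lookup v (fromℕ< i<k))) (cong (v !_) (Finₚ.toℕ-fromℕ< i<k))

!-< : ∀ {n k} (v : Vec (Fin n) k) {i} → i < k → v ! i < n
!-< (x ∷ xs) {zero}  _         = Finₚ.toℕ<n x
!-< (x ∷ xs) {suc i} (s≤s i<k) = !-< xs i<k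

!-ext : ∀ {n k} {v w : Vec (Fin n) k} → (∀ {i} → i < k → v ! i ≡ w ! i) → v ≡ w
!-ext {v = []}     {[]}     _  = refl
!-ext {v = x ∷ xs} {y ∷ ys} eq = cong₂ _∷_ (Finₚ.toℕ-injective (eq z<s)) (!-ext (eq ∘ s≤s))

!-map-inject₁ : ∀ {n k} (v : Vec (Fin n) k) i → Vec.map inject₁ v ! i ≡ v ! i
!-map-inject₁ []       _       = refl
!-map-inject₁ (x ∷ xs) zero    = Finₚ.toℕ-inject₁ x
!-map-inject₁ (x ∷ xs) (suc i) = !-map-inject₁ xs i

!-∷ʳ : ∀ {n k} (v : Vec (Fin n) k) x {i} → i < k → (v ∷ʳ x) ! i ≡ v ! i
!-∷ʳ (y ∷ ys) x {zero}  _         = refl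
!-∷ʳ (y ∷ ys) x {suc i} (s≤s i<k) = !-∷ʳ ys x i<k

!-∷ʳ-last : ∀ {n k} (v : Vec (Fin n) k) x → (v ∷ʳ x) ! k ≡ toℕ x
!-∷ʳ-last []       x = refl
!-∷ʳ-last (y ∷ ys) x = !-∷ʳ-last ys x

lower : ∀ {m k} (w : Vec (Fin (suc m)) k) → (∀ {i} → i < k → w ! i < m) → Vec (Fin m) k
lower []       _   = []
lower (x ∷ xs) w<m = fromℕ< (w<m z<s) ∷ lower xs (w<m ∘ s≤s)

!-lower : ∀ {m k} (w : Vec (Fin (suc m)) k) (w<m : ∀ {i} → i < k → w ! i < m) i →
          lower w w<m ! i ≡ w ! i
!-lower []       _   _       = refl
!-lower (x ∷ xs) w<m zero    = Finₚ.toℕ-fromℕ< _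
!-lower (x ∷ xs) w<m (suc i) = !-lower xs (w<m ∘ s≤s) i

map-inject₁-lower : ∀ {m k} (w : Vec (Fin (suc m)) k) (w<m : ∀ {i} → i < k → w ! i < m) →
                    Vec.map inject₁ (lower w w<m) ≡ w
map-inject₁-lower w w<m =
  !-ext (λ {i} _ → trans (!-map-inject₁ (lower w w<m) i) (!-lower w w<m i))

Distinct : ∀ {n k} → Vec (Fin n) k → Set
Distinct {k = k} v = ∀ {i j} → i < k → j < k → v ! i ≡ v ! j → i ≡ j

isPerm⇔distinct : ∀ {n} (v : Word n) → IsPerm v ⇔ Distinct v
isPerm⇔distinct v = mk⇔ perm⇒distinct distinct⇒perm
  where
  perm⇒distinct : IsPerm v → Distinct v
  perm⇒distinct perm {i} {j} i<n j<n vi≡vj =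
    trans (sym (Finₚ.toℕ-fromℕ< i<n))
      (trans (cong toℕ (perm _ _ (Finₚ.toℕ-injective
                (trans (!-fromℕ< v i<n) (trans vi≡vj (sym (!-fromℕ< v j<n)))))))
             (Finₚ.toℕ-fromℕ< j<n))
  distinct⇒perm : Distinct v → IsPerm v
  distinct⇒perm distinct p q vp≡vq = Finₚ.toℕ-injective (distinct (Finₚ.toℕ<n p) (Finₚ.toℕ<n q)
    (trans (!-lookup v p) (trans (cong toℕ vp≡vq) (sym (!-lookup v q)))))

distinct⇒surjective : ∀ {n} (v : Word n) → Distinct v →
                      ∀ {y} → y < n → ∃ λ p → p < n × v ! p ≡ y
distinct⇒surjective v distinct {y} y<n with Finₚ.any? (λ p → lookup v p Finₚ.≟ fromℕ< y<n)
... | yes (p , vp≡y) =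
  toℕ p , Finₚ.toℕ<n p , trans (!-lookup v p) (trans (cong toℕ vp≡y) (Finₚ.toℕ-fromℕ< y<n))
distinct⇒surjective {suc n} v distinct {y} y<n | no y∉v =
  ⊥-elim (Finₚ.<⇒notInjective (n<1+n n) skip-y-injective)
  where
  skip-y : Fin (suc n) → Fin n
  skip-y p = punchOut (λ y≡vp → y∉v (p , sym y≡vp))
  skip-y-injective : ∀ {p q} → skip-y p ≡ skip-y q → p ≡ q
  skip-y-injective {p} {q} eq = from (isPerm⇔distinct v) distinct p q
    (Finₚ.punchOut-injective (λ e → y∉v (p , sym e)) (λ e → y∉v (q , sym e)) eq)

distinct-<⊎> : ∀ {n k} (v : Vec (Fin n) k) → Distinct v →
               ∀ {i j} → i < k → j < k → i ≢ j → v ! i < v ! j ⊎ v ! j < v ! i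
distinct-<⊎> v distinct {i} {j} i<k j<k i≢j with <-cmp (v ! i) (v ! j)
... | tri< lt _ _ = inj₁ lt
... | tri≈ _ eq _ = ⊥-elim (i≢j (distinct i<k j<k eq))
... | tri> _ _ gt = inj₂ gt

below-max : ∀ {m} (v : Word (suc m)) → Distinct v →
            ∀ {p x} → p < suc m → x < suc m → v ! p ≡ m → x ≢ p → v ! x < m
below-max v distinct p<m x<m vp≡m x≢p =
  ≤∧≢⇒< (≤-pred (!-< v x<m)) (λ vx≡m → x≢p (distinct x<m p<m (trans vx≡m (sym vp≡m))))

distinct-∷ : ∀ {n k} (x : Fin n) (w : Vec (Fin n) k) → Distinct w →
             (∀ {i} → i < k → w ! i ≢ toℕ x) → Distinct (x ∷ w)
distinct-∷ _ _ distinct new {zero}  {zero}  _         _         _  = refl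
distinct-∷ _ _ distinct new {zero}  {suc j} _         (s≤s j<k) eq = ⊥-elim (new j<k (sym eq))
distinct-∷ _ _ distinct new {suc i} {zero}  (s≤s i<k) _         eq = ⊥-elim (new i<k eq)
distinct-∷ _ _ distinct new {suc i} {suc j} (s≤s i<k) (s≤s j<k) eq = cong suc (distinct i<k j<k eq)

distinct-map-inject₁ : ∀ {n k} (w : Vec (Fin n) k) → Distinct w → Distinct (Vec.map inject₁ w)
distinct-map-inject₁ w distinct {i} {j} i<k j<k eq =
  distinct i<k j<k (trans (sym (!-map-inject₁ w i)) (trans eq (!-map-inject₁ w j)))

-- Adding a new maximum

appendMax : ∀ {m} → Word m → Word (suc m)
appendMax {m} α = Vec.map inject₁ α ∷ʳ fromℕ m

prependMax : ∀ {m} → Word m → Word (suc m)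
prependMax {m} β = fromℕ m ∷ Vec.map inject₁ β

prependMax₂ : ∀ {k} → Word k → Word (suc (suc k))
prependMax₂ {k} β = inject₁ (fromℕ k) ∷ fromℕ (suc k) ∷ Vec.map inject₁ (Vec.map inject₁ β)

decreasing : ∀ m → Word m
decreasing zero    = []
decreasing (suc m) = prependMax (decreasing m)

appendMax-! : ∀ {m} (α : Word m) {i} → i < m → appendMax α ! i ≡ α ! i
appendMax-! α {i} i<m = trans (!-∷ʳ (Vec.map inject₁ α) _ i<m) (!-map-inject₁ α i)

appendMax-!-last : ∀ {m} (α : Word m) → appendMax α ! m ≡ m
appendMax-!-last {m} α = trans (!-∷ʳ-last (Vec.map inject₁ α) _) (Finₚ.toℕ-fromℕ m)

prependMax-!-first : ∀ {m} (β : Word m) → prependMax β ! 0 ≡ m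
prependMax-!-first {m} β = Finₚ.toℕ-fromℕ m

prependMax-!-suc : ∀ {m} (β : Word m) i → prependMax β ! suc i ≡ β ! i
prependMax-!-suc β i = !-map-inject₁ β i

prependMax₂-!-first : ∀ {k} (β : Word k) → prependMax₂ β ! 0 ≡ k
prependMax₂-!-first {k} β = trans (Finₚ.toℕ-inject₁ (fromℕ k)) (Finₚ.toℕ-fromℕ k)

prependMax₂-!-second : ∀ {k} (β : Word k) → prependMax₂ β ! 1 ≡ suc k
prependMax₂-!-second {k} β = Finₚ.toℕ-fromℕ (suc k)

prependMax₂-!-suc-suc : ∀ {k} (β : Word k) i → prependMax₂ β ! suc (suc i) ≡ β ! i
prependMax₂-!-suc-suc β i = trans (!-map-inject₁ (Vec.map inject₁ β) i) (!-map-inject₁ β i)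

appendMax-injective : ∀ {m} {α α′ : Word m} → appendMax α ≡ appendMax α′ → α ≡ α′
appendMax-injective {α = α} {α′} eq = !-ext λ {i} i<m →
  trans (sym (appendMax-! α i<m)) (trans (cong (_! i) eq) (appendMax-! α′ i<m))

prependMax-injective : ∀ {m} {β β′ : Word m} → prependMax β ≡ prependMax β′ → β ≡ β′
prependMax-injective {β = β} {β′} eq = !-ext λ {i} _ →
  trans (sym (prependMax-!-suc β i)) (trans (cong (_! suc i) eq) (prependMax-!-suc β′ i))

prependMax₂-injective : ∀ {k} {β β′ : Word k} → prependMax₂ β ≡ prependMax₂ β′ → β ≡ β′
prependMax₂-injective {β = β} {β′} eq = !-ext λ {i} _ →
  trans (sym (prependMax₂-!-suc-suc β i))
        (trans (cong (_! suc (suc i)) eq) (prependMax₂-!-suc-suc β′ i))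

appendMax≢prependMax : ∀ {k} (α β : Word (suc k)) → appendMax α ≢ prependMax β
appendMax≢prependMax α β eq = <-irrefl
  (trans (sym (appendMax-! α z<s)) (trans (cong (_! 0) eq) (prependMax-!-first β)))
  (!-< α z<s)

appendMax≢prependMax₂ : ∀ {k} (α : Word (suc (suc k))) (β : Word (suc k)) →
                        appendMax α ≢ prependMax₂ β
appendMax≢prependMax₂ α β eq = <-irrefl
  (trans (sym (appendMax-! α (s<s z<s))) (trans (cong (_! 1) eq) (prependMax₂-!-second β)))
  (!-< α (s<s z<s))

prependMax≢prependMax₂ : ∀ {k} (α : Word (suc (suc k))) (β : Word (suc k)) →
                         prependMax α ≢ prependMax₂ β
prependMax≢prependMax₂ {k} α β eq = <-irrefl
  (trans (sym (prependMax₂-!-first β)) (trans (cong (_! 0) (sym eq)) (prependMax-!-first α)))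
  (n<1+n (suc k))

max-last⇒appendMax : ∀ {m} (v : Word (suc m)) → Distinct v → v ! m ≡ m →
                     ∃ λ α → v ≡ appendMax α
max-last⇒appendMax {m} v distinct vm≡m with initLast v
... | ys , y , refl = lower ys ys<m , cong₂ _∷ʳ_ (sym (map-inject₁-lower ys ys<m)) y≡m
  where
  ys<m : ∀ {i} → i < m → ys ! i < m
  ys<m {i} i<m = subst (_< m) (!-∷ʳ ys y i<m)
    (below-max (ys ∷ʳ y) distinct (n<1+n m) (m<n⇒m<1+n i<m) vm≡m (<⇒≢ i<m))
  y≡m : y ≡ fromℕ m
  y≡m = Finₚ.toℕ-injective (trans (sym (!-∷ʳ-last ys y)) (trans vm≡m (sym (Finₚ.toℕ-fromℕ m))))

max-first⇒prependMax : ∀ {m} (v : Word (suc m)) → Distinct v → v ! 0 ≡ m →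
                       ∃ λ β → v ≡ prependMax β
max-first⇒prependMax {m} (x ∷ xs) distinct v0≡m =
  lower xs xs<m , cong₂ _∷_ x≡m (sym (map-inject₁-lower xs xs<m))
  where
  xs<m : ∀ {i} → i < m → xs ! i < m
  xs<m i<m = below-max (x ∷ xs) distinct z<s (s<s i<m) v0≡m (λ ())
  x≡m : x ≡ fromℕ m
  x≡m = Finₚ.toℕ-injective (trans v0≡m (sym (Finₚ.toℕ-fromℕ m)))

max-second⇒prependMax₂ : ∀ {k} (v : Word (suc (suc k))) → Distinct v → v ! 0 ≡ k → v ! 1 ≡ suc k →
                         ∃ λ β → v ≡ prependMax₂ β
max-second⇒prependMax₂ {k} (x ∷ x′ ∷ xs) distinct v0≡k v1≡1+k =
  lower xs′ xs′<k ,
  cong₂ _∷_ x≡k (cong₂ _∷_ x′≡1+k (sym (trans (cong (Vec.map inject₁) (map-inject₁-lower xs′ xs′<k))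
                                               (map-inject₁-lower xs xs<1+k))))
  where
  xs<1+k : ∀ {i} → i < k → xs ! i < suc k
  xs<1+k i<k = below-max (x ∷ x′ ∷ xs) distinct (s<s z<s) (s<s (s<s i<k)) v1≡1+k (λ ())
  xs′ = lower xs xs<1+k
  xs′<k : ∀ {i} → i < k → xs′ ! i < k
  xs′<k {i} i<k = subst (_< k) (sym (!-lower xs xs<1+k i)) (≤∧≢⇒< (≤-pred (xs<1+k i<k))
    (λ xi≡k → 1+n≢0 (distinct (s<s (s<s i<k)) z<s (trans xi≡k (sym v0≡k)))))
  x≡k : x ≡ inject₁ (fromℕ k)
  x≡k = Finₚ.toℕ-injective
    (trans v0≡k (sym (trans (Finₚ.toℕ-inject₁ (fromℕ k)) (Finₚ.toℕ-fromℕ k))))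
  x′≡1+k : x′ ≡ fromℕ (suc k)
  x′≡1+k = Finₚ.toℕ-injective (trans v1≡1+k (sym (Finₚ.toℕ-fromℕ (suc k))))

-- Occurrences of patterns

data Occ12 {n k} (v : Vec (Fin n) k) : Set where
  occ12 : ∀ i j → i < j → j < k → v ! i < v ! j → Occ12 v

data Occ123 {n k} (v : Vec (Fin n) k) : Set where
  occ123 : ∀ i j l → i < j → j < l → l < k → v ! i < v ! j → v ! j < v ! l → Occ123 v

data Occ132 {n k} (v : Vec (Fin n) k) : Set where
  occ132 : ∀ i j l → i < j → j < l → l < k → v ! i < v ! l → v ! l < v ! j → Occ132 v

data Occ312 {n k} (v : Vec (Fin n) k) : Set where
  occ312 : ∀ i j l → i < j → j < l → l < k → v ! j < v ! l → v ! l < v ! i → Occ312 v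

data Occ4123 {n k} (v : Vec (Fin n) k) : Set where
  occ4123 : ∀ i j l o → i < j → j < l → l < o → o < k →
            v ! j < v ! l → v ! l < v ! o → v ! o < v ! i → Occ4123 v

-- 2341 and 3241 differ only in the order of their first two entries, which no
-- argument below looks at, so their occurrences are treated together.
data Occ2341∨3241 {n k} (v : Vec (Fin n) k) : Set where
  occ2341∨3241 : ∀ i j l o → i < j → j < l → l < o → o < k →
                 v ! o < v ! i → v ! o < v ! j → v ! i < v ! l → v ! j < v ! l → Occ2341∨3241 v

occ123⇒occ12 : ∀ {n k} {v : Vec (Fin n) k} → Occ123 v → Occ12 v
occ123⇒occ12 (occ123 i j l i<j j<l l<k vi<vj _) = occ12 i j i<j (<-trans j<l l<k) vi<vj

occ132⇒occ12 : ∀ {n k} {v : Vec (Fin n) k} → Occ132 v → Occ12 v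
occ132⇒occ12 (occ132 i j l i<j j<l l<k vi<vl vl<vj) =
  occ12 i j i<j (<-trans j<l l<k) (<-trans vi<vl vl<vj)

occ312⇒occ12 : ∀ {n k} {v : Vec (Fin n) k} → Occ312 v → Occ12 v
occ312⇒occ12 (occ312 i j l _ j<l l<k vj<vl _) = occ12 j l j<l l<k vj<vl

occ4123⇒occ123 : ∀ {n k} {v : Vec (Fin n) k} → Occ4123 v → Occ123 v
occ4123⇒occ123 (occ4123 i j l o _ j<l l<o o<k vj<vl vl<vo _) = occ123 j l o j<l l<o o<k vj<vl vl<vo

occ2341∨3241⇒occ12 : ∀ {n k} {v : Vec (Fin n) k} → Occ2341∨3241 v → Occ12 v
occ2341∨3241⇒occ12 (occ2341∨3241 i j l o i<j j<l l<o o<k _ _ vi<vl _) =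
  occ12 i l (<-trans i<j j<l) (<-trans l<o o<k) vi<vl

split-∷ʳ : ∀ {k n} (ps : Vec ℕ k) → Linked _<_ (ps ∷ʳ n) → Linked _<_ ps × AllV.All (_< n) ps
split-∷ʳ []           _              = [] , []
split-∷ʳ (p ∷ [])     (p<n ∷ [-])    = [-] , p<n ∷ []
split-∷ʳ (p ∷ q ∷ ps) (p<q ∷ q∷ps<n) with split-∷ʳ (q ∷ ps) q∷ps<n
... | q∷ps-linked , q<n ∷ ps<n = p<q ∷ q∷ps-linked , <-trans p<q q<n ∷ q<n ∷ ps<n

-- σ⁻¹ lists the pattern positions in increasing order of value, so the two chains
-- say that the positions ps increase and that their values in v are ordered like σ.
contains-intro : ∀ {n k} (v : Word n) (σ σ⁻¹ : Word k) → (∀ i → lookup σ⁻¹ (lookup σ i) ≡ i) →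
                 (ps : Vec ℕ k) → Linked _<_ (ps ∷ʳ n) →
                 Linked _<_ (Vec.map (λ i → v ! lookup ps i) σ⁻¹) → Contains v σ
contains-intro {n} {k} v σ σ⁻¹ inverse ps ps-chain value-chain =
  f , f-mono , λ i j → mk⇔ (order i j) (reflect i j)
  where
  ps<n : ∀ i → lookup ps i < n
  ps<n = AllVₚ.lookup⁺ (proj₂ (split-∷ʳ ps ps-chain))

  f : Fin k → Fin n
  f i = fromℕ< (ps<n i)

  f-mono : ∀ i j → i Fin.< j → f i Fin.< f j
  f-mono i j i<j = subst₂ _<_ (sym (Finₚ.toℕ-fromℕ< (ps<n i))) (sym (Finₚ.toℕ-fromℕ< (ps<n j)))
    (Linkedₚ.lookup⁺ <-trans (proj₁ (split-∷ʳ ps ps-chain)) i<j)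

  value : ∀ i → lookup (Vec.map (λ i → v ! lookup ps i) σ⁻¹) (lookup σ i) ≡ toℕ (lookup v (f i))
  value i = trans (lookup-map (lookup σ i) _ σ⁻¹)
                  (trans (cong (λ i → v ! lookup ps i) (inverse i)) (sym (!-fromℕ< v (ps<n i))))

  order : ∀ i j → lookup σ i Fin.< lookup σ j → lookup v (f i) Fin.< lookup v (f j)
  order i j σi<σj = subst₂ _<_ (value i) (value j) (Linkedₚ.lookup⁺ <-trans value-chain σi<σj)

  reflect : ∀ i j → lookup v (f i) Fin.< lookup v (f j) → lookup σ i Fin.< lookup σ j
  reflect i j vi<vj with Finₚ.<-cmp (lookup σ i) (lookup σ j)
  ... | tri< σi<σj _ _ = σi<σj
  ... | tri≈ _ σi≡σj _ = ⊥-elim (<-irrefl (cong (toℕ ∘ lookup v ∘ f) i≡j) vi<vj)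
    where i≡j = trans (sym (inverse i)) (trans (cong (lookup σ⁻¹) σi≡σj) (inverse j))
  ... | tri> _ _ σj<σi = ⊥-elim (<-asym vi<vj (order j i σj<σi))

module ContainsPositions {n k} (v : Word n) (σ : Word k) (c : Contains v σ) where
  pos : Fin k → ℕ
  pos i = toℕ (proj₁ c i)

  pos-mono : ∀ i j → i Fin.< j → pos i < pos j
  pos-mono = proj₁ (proj₂ c)

  pos-< : ∀ i → pos i < n
  pos-< i = Finₚ.toℕ<n (proj₁ c i)

  pos-! : ∀ i j → lookup σ i Fin.< lookup σ j → v ! pos i < v ! pos j
  pos-! i j σi<σj =
    subst₂ _<_ (sym (!-lookup v _)) (sym (!-lookup v _)) (to (proj₂ (proj₂ c) i j) σi<σj)

occ132⇒contains : ∀ {n} {v : Word n} → Occ132 v → Contains v p132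
occ132⇒contains {v = v} (occ132 i j l i<j j<l l<n x y) =
  contains-intro v p132 p132 (λ { 0F → refl ; 1F → refl ; 2F → refl })
    (i ∷ j ∷ l ∷ []) (i<j ∷ j<l ∷ l<n ∷ [-]) (x ∷ y ∷ [-])

contains⇒occ132 : ∀ {n} {v : Word n} → Contains v p132 → Occ132 v
contains⇒occ132 {v = v} c =
  occ132 _ _ _ (pos-mono 0F 1F z<s) (pos-mono 1F 2F (s<s z<s)) (pos-< 2F)
    (pos-! 0F 2F z<s) (pos-! 2F 1F (s<s z<s))
  where open ContainsPositions v p132 c

occ312⇒contains : ∀ {n} {v : Word n} → Occ312 v → Contains v p312
occ312⇒contains {v = v} (occ312 i j l i<j j<l l<n x y) =
  contains-intro v p312 (1F ∷ 2F ∷ 0F ∷ []) (λ { 0F → refl ; 1F → refl ; 2F → refl })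
    (i ∷ j ∷ l ∷ []) (i<j ∷ j<l ∷ l<n ∷ [-]) (x ∷ y ∷ [-])

contains⇒occ312 : ∀ {n} {v : Word n} → Contains v p312 → Occ312 v
contains⇒occ312 {v = v} c =
  occ312 _ _ _ (pos-mono 0F 1F z<s) (pos-mono 1F 2F (s<s z<s)) (pos-< 2F)
    (pos-! 1F 2F z<s) (pos-! 2F 0F (s<s z<s))
  where open ContainsPositions v p312 c

occ4123⇒contains : ∀ {n} {v : Word n} → Occ4123 v → Contains v p4123
occ4123⇒contains {v = v} (occ4123 i j l o i<j j<l l<o o<n x y z) =
  contains-intro v p4123 (1F ∷ 2F ∷ 3F ∷ 0F ∷ []) (λ { 0F → refl ; 1F → refl ; 2F → refl ; 3F → refl })
    (i ∷ j ∷ l ∷ o ∷ []) (i<j ∷ j<l ∷ l<o ∷ o<n ∷ [-]) (x ∷ y ∷ z ∷ [-])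

contains⇒occ4123 : ∀ {n} {v : Word n} → Contains v p4123 → Occ4123 v
contains⇒occ4123 {v = v} c =
  occ4123 _ _ _ _ (pos-mono 0F 1F z<s) (pos-mono 1F 2F (s<s z<s)) (pos-mono 2F 3F (s<s (s<s z<s)))
    (pos-< 3F) (pos-! 1F 2F z<s) (pos-! 2F 3F (s<s z<s)) (pos-! 3F 0F (s<s (s<s z<s)))
  where open ContainsPositions v p4123 c

occ2341∨3241⇒contains : ∀ {n} {v : Word n} → Distinct v → Occ2341∨3241 v →
                        Contains v p2341 ⊎ Contains v p3241
occ2341∨3241⇒contains {v = v} distinct (occ2341∨3241 i j l o i<j j<l l<o o<n x y z t)
  with distinct-<⊎> v distinct (<-trans i<j j<n) j<n (<⇒≢ i<j)
  where j<n = <-trans j<l (<-trans l<o o<n)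
... | inj₁ vi<vj = inj₁
  (contains-intro v p2341 (3F ∷ 0F ∷ 1F ∷ 2F ∷ []) (λ { 0F → refl ; 1F → refl ; 2F → refl ; 3F → refl })
     (i ∷ j ∷ l ∷ o ∷ []) (i<j ∷ j<l ∷ l<o ∷ o<n ∷ [-]) (x ∷ vi<vj ∷ t ∷ [-]))
... | inj₂ vj<vi = inj₂
  (contains-intro v p3241 (3F ∷ 1F ∷ 0F ∷ 2F ∷ []) (λ { 0F → refl ; 1F → refl ; 2F → refl ; 3F → refl })
     (i ∷ j ∷ l ∷ o ∷ []) (i<j ∷ j<l ∷ l<o ∷ o<n ∷ [-]) (y ∷ vj<vi ∷ z ∷ [-]))

contains2341⇒occ : ∀ {n} {v : Word n} → Contains v p2341 → Occ2341∨3241 v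
contains2341⇒occ {v = v} c =
  occ2341∨3241 _ _ _ _ (pos-mono 0F 1F z<s) (pos-mono 1F 2F (s<s z<s)) (pos-mono 2F 3F (s<s (s<s z<s)))
    (pos-< 3F) (pos-! 3F 0F z<s) (pos-! 3F 1F z<s) (pos-! 0F 2F (s<s z<s)) (pos-! 1F 2F (s<s (s<s z<s)))
  where open ContainsPositions v p2341 c

contains3241⇒occ : ∀ {n} {v : Word n} → Contains v p3241 → Occ2341∨3241 v
contains3241⇒occ {v = v} c =
  occ2341∨3241 _ _ _ _ (pos-mono 0F 1F z<s) (pos-mono 1F 2F (s<s z<s)) (pos-mono 2F 3F (s<s (s<s z<s)))
    (pos-< 3F) (pos-! 3F 0F z<s) (pos-! 3F 1F z<s) (pos-! 0F 2F (s<s (s<s z<s))) (pos-! 1F 2F (s<s z<s))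
  where open ContainsPositions v p3241 c

record Embedding {n n′ k k′} (w : Vec (Fin n) k) (v : Vec (Fin n′) k′) : Set where
  field
    pos      : ℕ → ℕ
    pos-mono : ∀ {i j} → i < j → pos i < pos j
    pos-<    : ∀ {i} → i < k → pos i < k′
    pos-!    : ∀ {i} → i < k → v ! pos i ≡ w ! i

module _ {n n′ k k′} {w : Vec (Fin n) k} {v : Vec (Fin n′) k′} (e : Embedding w v) where
  open Embedding e

  private
    embed-< : ∀ {i j} → i < k → j < k → w ! i < w ! j → v ! pos i < v ! pos j
    embed-< i<k j<k = subst₂ _<_ (sym (pos-! i<k)) (sym (pos-! j<k))

    pos-injective : ∀ {i j} → pos i ≡ pos j → i ≡ j
    pos-injective {i} {j} eq with <-cmp i j
    ... | tri< i<j _ _ = ⊥-elim (<-irrefl eq (pos-mono i<j))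
    ... | tri≈ _ i≡j _ = i≡j
    ... | tri> _ _ j<i = ⊥-elim (<-irrefl (sym eq) (pos-mono j<i))

  embed-distinct : Distinct v → Distinct w
  embed-distinct distinct i<k j<k wi≡wj = pos-injective
    (distinct (pos-< i<k) (pos-< j<k) (trans (pos-! i<k) (trans wi≡wj (sym (pos-! j<k)))))

  embed-occ12 : Occ12 w → Occ12 v
  embed-occ12 (occ12 i j i<j j<k x) =
    occ12 _ _ (pos-mono i<j) (pos-< j<k) (embed-< (<-trans i<j j<k) j<k x)

  embed-occ123 : Occ123 w → Occ123 v
  embed-occ123 (occ123 i j l i<j j<l l<k x y) =
    occ123 _ _ _ (pos-mono i<j) (pos-mono j<l) (pos-< l<k) (embed-< i<k j<k x) (embed-< j<k l<k y)
    where j<k = <-trans j<l l<k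
          i<k = <-trans i<j j<k

  embed-occ132 : Occ132 w → Occ132 v
  embed-occ132 (occ132 i j l i<j j<l l<k x y) =
    occ132 _ _ _ (pos-mono i<j) (pos-mono j<l) (pos-< l<k) (embed-< i<k l<k x) (embed-< l<k j<k y)
    where j<k = <-trans j<l l<k
          i<k = <-trans i<j j<k

  embed-occ312 : Occ312 w → Occ312 v
  embed-occ312 (occ312 i j l i<j j<l l<k x y) =
    occ312 _ _ _ (pos-mono i<j) (pos-mono j<l) (pos-< l<k) (embed-< j<k l<k x) (embed-< l<k i<k y)
    where j<k = <-trans j<l l<k
          i<k = <-trans i<j j<k

  embed-occ4123 : Occ4123 w → Occ4123 v
  embed-occ4123 (occ4123 i j l o i<j j<l l<o o<k x y z) =
    occ4123 _ _ _ _ (pos-mono i<j) (pos-mono j<l) (pos-mono l<o) (pos-< o<k)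
      (embed-< j<k l<k x) (embed-< l<k o<k y) (embed-< o<k i<k z)
    where l<k = <-trans l<o o<k
          j<k = <-trans j<l l<k
          i<k = <-trans i<j j<k

  embed-occ2341∨3241 : Occ2341∨3241 w → Occ2341∨3241 v
  embed-occ2341∨3241 (occ2341∨3241 i j l o i<j j<l l<o o<k x y z t) =
    occ2341∨3241 _ _ _ _ (pos-mono i<j) (pos-mono j<l) (pos-mono l<o) (pos-< o<k)
      (embed-< o<k i<k x) (embed-< o<k j<k y) (embed-< i<k l<k z) (embed-< j<k l<k t)
    where l<k = <-trans l<o o<k
          j<k = <-trans j<l l<k
          i<k = <-trans i<j j<k

  module _ {top} (top<pos : ∀ {i} → i < k → top < pos i)
                 (pos<top : ∀ {i} → i < k → v ! pos i < v ! top) where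

    extend-occ312 : Occ12 w → Occ312 v
    extend-occ312 (occ12 i j i<j j<k x) =
      occ312 top _ _ (top<pos (<-trans i<j j<k)) (pos-mono i<j) (pos-< j<k)
        (embed-< (<-trans i<j j<k) j<k x) (pos<top j<k)

    extend-occ4123 : Occ123 w → Occ4123 v
    extend-occ4123 (occ123 i j l i<j j<l l<k x y) =
      occ4123 top _ _ _ (top<pos i<k) (pos-mono i<j) (pos-mono j<l) (pos-< l<k)
        (embed-< i<k j<k x) (embed-< j<k l<k y) (pos<top l<k)
      where j<k = <-trans j<l l<k
            i<k = <-trans i<j j<k

appendMax-embedding : ∀ {m} (α : Word m) → Embedding α (appendMax α)
appendMax-embedding α = record
  { pos = λ i → i ; pos-mono = λ i<j → i<j ; pos-< = m<n⇒m<1+n ; pos-! = appendMax-! α }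

prependMax-embedding : ∀ {m} (β : Word m) → Embedding β (prependMax β)
prependMax-embedding β = record
  { pos = suc ; pos-mono = s<s ; pos-< = s<s ; pos-! = λ {i} _ → prependMax-!-suc β i }

prependMax₂-embedding : ∀ {k} (β : Word k) → Embedding β (prependMax₂ β)
prependMax₂-embedding β = record
  { pos = suc ∘ suc ; pos-mono = s<s ∘ s<s ; pos-< = s<s ∘ s<s
  ; pos-! = λ {i} _ → prependMax₂-!-suc-suc β i }

module _ {m} (α : Word m) where
  private
    v = appendMax α

    last-on-top : ∀ {j} → j < suc m → ¬ (v ! m < v ! j)
    last-on-top {j} j<1+m vm<vj =
      <⇒≱ (subst (_< v ! j) (appendMax-!-last α) vm<vj) (≤-pred (!-< v j<1+m))

    below-or-last : ∀ {l} → l < suc m → l < m ⊎ l ≡ m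
    below-or-last l<1+m = m≤n⇒m<n∨m≡n (≤-pred l<1+m)

    restrict-< : ∀ {i j} → i < m → j < m → v ! i < v ! j → α ! i < α ! j
    restrict-< i<m j<m = subst₂ _<_ (appendMax-! α i<m) (appendMax-! α j<m)

  appendMax-distinct : Distinct (appendMax α) ⇔ Distinct α
  appendMax-distinct = mk⇔ (embed-distinct (appendMax-embedding α)) extend
    where
    entry : ∀ {i} → i < suc m → (i < m × v ! i ≡ α ! i) ⊎ (i ≡ m × v ! i ≡ m)
    entry i<1+m with below-or-last i<1+m
    ... | inj₁ i<m  = inj₁ (i<m , appendMax-! α i<m)
    ... | inj₂ refl = inj₂ (refl , appendMax-!-last α)
    extend : Distinct α → Distinct (appendMax α)
    extend distinct i<1+m j<1+m vi≡vj with entry i<1+m | entry j<1+m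
    ... | inj₁ (i<m , vi) | inj₁ (j<m , vj) = distinct i<m j<m (trans (sym vi) (trans vi≡vj vj))
    ... | inj₁ (i<m , vi) | inj₂ (refl , vj) =
      ⊥-elim (<-irrefl (trans (sym vi) (trans vi≡vj vj)) (!-< α i<m))
    ... | inj₂ (refl , vi) | inj₁ (j<m , vj) =
      ⊥-elim (<-irrefl (trans (sym vj) (trans (sym vi≡vj) vi)) (!-< α j<m))
    ... | inj₂ (refl , _) | inj₂ (refl , _) = refl

  appendMax-occ132 : Occ132 (appendMax α) ⇔ Occ132 α
  appendMax-occ132 = mk⇔ restrict (embed-occ132 (appendMax-embedding α))
    where
    restrict : Occ132 v → Occ132 α
    restrict (occ132 i j l i<j j<l l<1+m x y) with below-or-last l<1+m
    ... | inj₂ refl = ⊥-elim (last-on-top (<-trans j<l l<1+m) y)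
    ... | inj₁ l<m  = occ132 i j l i<j j<l l<m (restrict-< i<m l<m x) (restrict-< l<m j<m y)
      where j<m = <-trans j<l l<m
            i<m = <-trans i<j j<m

  appendMax-occ312 : Occ312 (appendMax α) ⇔ Occ312 α
  appendMax-occ312 = mk⇔ restrict (embed-occ312 (appendMax-embedding α))
    where
    restrict : Occ312 v → Occ312 α
    restrict (occ312 i j l i<j j<l l<1+m x y) with below-or-last l<1+m
    ... | inj₂ refl = ⊥-elim (last-on-top (<-trans (<-trans i<j j<l) l<1+m) y)
    ... | inj₁ l<m  = occ312 i j l i<j j<l l<m (restrict-< j<m l<m x) (restrict-< l<m i<m y)
      where j<m = <-trans j<l l<m
            i<m = <-trans i<j j<m

  appendMax-occ4123 : Occ4123 (appendMax α) ⇔ Occ4123 α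
  appendMax-occ4123 = mk⇔ restrict (embed-occ4123 (appendMax-embedding α))
    where
    restrict : Occ4123 v → Occ4123 α
    restrict (occ4123 i j l o i<j j<l l<o o<1+m x y z) with below-or-last o<1+m
    ... | inj₂ refl = ⊥-elim (last-on-top (<-trans (<-trans i<j (<-trans j<l l<o)) o<1+m) z)
    ... | inj₁ o<m  = occ4123 i j l o i<j j<l l<o o<m
                        (restrict-< j<m l<m x) (restrict-< l<m o<m y) (restrict-< o<m i<m z)
      where l<m = <-trans l<o o<m
            j<m = <-trans j<l l<m
            i<m = <-trans i<j j<m

  appendMax-occ2341∨3241 : Occ2341∨3241 (appendMax α) ⇔ Occ2341∨3241 α
  appendMax-occ2341∨3241 = mk⇔ restrict (embed-occ2341∨3241 (appendMax-embedding α))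
    where
    restrict : Occ2341∨3241 v → Occ2341∨3241 α
    restrict (occ2341∨3241 i j l o i<j j<l l<o o<1+m x y z t) with below-or-last o<1+m
    ... | inj₂ refl = ⊥-elim (last-on-top (<-trans (<-trans i<j (<-trans j<l l<o)) o<1+m) x)
    ... | inj₁ o<m  = occ2341∨3241 i j l o i<j j<l l<o o<m
                        (restrict-< o<m i<m x) (restrict-< o<m j<m y)
                        (restrict-< i<m l<m z) (restrict-< j<m l<m t)
      where l<m = <-trans l<o o<m
            j<m = <-trans j<l l<m
            i<m = <-trans i<j j<m

  appendMax-occ123 : Occ123 (appendMax α) ⇔ Occ12 α
  appendMax-occ123 = mk⇔ restrict extend
    where
    restrict : Occ123 v → Occ12 α
    restrict (occ123 i j l i<j j<l l<1+m x _) =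
      occ12 i j i<j j<m (restrict-< (<-trans i<j j<m) j<m x)
      where j<m = <-≤-trans j<l (≤-pred l<1+m)
    extend : Occ12 α → Occ123 v
    extend (occ12 i j i<j j<m x) = occ123 i j m i<j j<m (n<1+n m)
      (subst₂ _<_ (sym (appendMax-! α (<-trans i<j j<m))) (sym (appendMax-! α j<m)) x)
      (subst₂ _<_ (sym (appendMax-! α j<m)) (sym (appendMax-!-last α)) (!-< α j<m))

module _ {m} (β : Word m) where
  private
    v = prependMax β

    first-on-top : ∀ {l} → l < suc m → ¬ (v ! 0 < v ! l)
    first-on-top {l} l<1+m v0<vl =
      <⇒≱ (subst (_< v ! l) (prependMax-!-first β) v0<vl) (≤-pred (!-< v l<1+m))

    restrict-< : ∀ {i j} → v ! suc i < v ! suc j → β ! i < β ! j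
    restrict-< {i} {j} = subst₂ _<_ (prependMax-!-suc β i) (prependMax-!-suc β j)

    tail-below-first : ∀ {i} → i < m → v ! suc i < v ! 0
    tail-below-first {i} i<m =
      subst₂ _<_ (sym (prependMax-!-suc β i)) (sym (prependMax-!-first β)) (!-< β i<m)

  prependMax-distinct : Distinct (prependMax β) ⇔ Distinct β
  prependMax-distinct = mk⇔ (embed-distinct (prependMax-embedding β))
    (λ distinct → distinct-∷ _ _ (distinct-map-inject₁ β distinct) (<⇒≢ ∘ tail-below-first))

  prependMax-occ12 : Occ12 (prependMax β) ⇔ Occ12 β
  prependMax-occ12 = mk⇔ restrict (embed-occ12 (prependMax-embedding β))
    where
    restrict : Occ12 v → Occ12 β
    restrict (occ12 zero    j       _         j<1+m     x) = ⊥-elim (first-on-top j<1+m x)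
    restrict (occ12 (suc i) (suc j) (s≤s i<j) (s≤s j<m) x) = occ12 i j i<j j<m (restrict-< x)

  prependMax-occ123 : Occ123 (prependMax β) ⇔ Occ123 β
  prependMax-occ123 = mk⇔ restrict (embed-occ123 (prependMax-embedding β))
    where
    restrict : Occ123 v → Occ123 β
    restrict (occ123 zero j l _ _ l<1+m x y) = ⊥-elim (first-on-top l<1+m (<-trans x y))
    restrict (occ123 (suc i) (suc j) (suc l) (s≤s i<j) (s≤s j<l) (s≤s l<m) x y) =
      occ123 i j l i<j j<l l<m (restrict-< x) (restrict-< y)

  prependMax-occ132 : Occ132 (prependMax β) ⇔ Occ132 β
  prependMax-occ132 = mk⇔ restrict (embed-occ132 (prependMax-embedding β))
    where
    restrict : Occ132 v → Occ132 β
    restrict (occ132 zero j l _ _ l<1+m x _) = ⊥-elim (first-on-top l<1+m x)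
    restrict (occ132 (suc i) (suc j) (suc l) (s≤s i<j) (s≤s j<l) (s≤s l<m) x y) =
      occ132 i j l i<j j<l l<m (restrict-< x) (restrict-< y)

  prependMax-occ2341∨3241 : Occ2341∨3241 (prependMax β) ⇔ Occ2341∨3241 β
  prependMax-occ2341∨3241 = mk⇔ restrict (embed-occ2341∨3241 (prependMax-embedding β))
    where
    restrict : Occ2341∨3241 v → Occ2341∨3241 β
    restrict (occ2341∨3241 zero j l o _ _ l<o o<1+m _ _ z _) =
      ⊥-elim (first-on-top (<-trans l<o o<1+m) z)
    restrict (occ2341∨3241 (suc i) (suc j) (suc l) (suc o)
                           (s≤s i<j) (s≤s j<l) (s≤s l<o) (s≤s o<m) x y z t) =
      occ2341∨3241 i j l o i<j j<l l<o o<m (restrict-< x) (restrict-< y) (restrict-< z) (restrict-< t)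

  prependMax-occ312 : Occ312 (prependMax β) ⇔ Occ12 β
  prependMax-occ312 =
    mk⇔ restrict (extend-occ312 (prependMax-embedding β) (λ _ → z<s) tail-below-first)
    where
    restrict : Occ312 v → Occ12 β
    restrict (occ312 i (suc j) (suc l) _ (s≤s j<l) (s≤s l<m) x _) = occ12 j l j<l l<m (restrict-< x)

  prependMax-occ4123 : Occ4123 (prependMax β) ⇔ Occ123 β
  prependMax-occ4123 =
    mk⇔ restrict (extend-occ4123 (prependMax-embedding β) (λ _ → z<s) tail-below-first)
    where
    restrict : Occ4123 v → Occ123 β
    restrict (occ4123 i (suc j) (suc l) (suc o) _ (s≤s j<l) (s≤s l<o) (s≤s o<m) x y _) =
      occ123 j l o j<l l<o o<m (restrict-< x) (restrict-< y)

module _ {k} (β : Word k) where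
  private
    v = prependMax₂ β

    tail-below-first : ∀ {i} → i < k → v ! suc (suc i) < v ! 0
    tail-below-first {i} i<k =
      subst₂ _<_ (sym (prependMax₂-!-suc-suc β i)) (sym (prependMax₂-!-first β)) (!-< β i<k)

    first-below-second : v ! 0 < v ! 1
    first-below-second =
      subst₂ _<_ (sym (prependMax₂-!-first β)) (sym (prependMax₂-!-second β)) (n<1+n k)

    tail-below-second : ∀ {i} → i < k → v ! suc (suc i) < v ! 1
    tail-below-second i<k = <-trans (tail-below-first i<k) first-below-second

    head-on-top : ∀ {i l} → i < 2 → 2 ≤ l → l < suc (suc k) → ¬ (v ! i < v ! l)
    head-on-top {zero}        {suc (suc l)} _ _ (s≤s (s≤s l<k)) = <-asym (tail-below-first l<k)
    head-on-top {suc zero}    {suc (suc l)} _ _ (s≤s (s≤s l<k)) = <-asym (tail-below-second l<k)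
    head-on-top {suc (suc _)} (s≤s (s≤s ()))
    head-on-top {l = suc zero} _ (s≤s ())

    2≤third : ∀ {i j l} → i < j → j < l → 2 ≤ l
    2≤third i<j j<l = ≤-<-trans (≤-trans (s≤s z≤n) i<j) j<l

    restrict-< : ∀ {i j} → v ! suc (suc i) < v ! suc (suc j) → β ! i < β ! j
    restrict-< {i} {j} = subst₂ _<_ (prependMax₂-!-suc-suc β i) (prependMax₂-!-suc-suc β j)

  prependMax₂-distinct : Distinct (prependMax₂ β) ⇔ Distinct β
  prependMax₂-distinct = mk⇔ (embed-distinct (prependMax₂-embedding β)) extend
    where
    new-first : ∀ {i} → i < suc k → v ! suc i ≢ v ! 0
    new-first {zero}  _         = ≢-sym (<⇒≢ first-below-second)
    new-first {suc i} (s≤s i<k) = <⇒≢ (tail-below-first i<k)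
    extend : Distinct β → Distinct (prependMax₂ β)
    extend distinct = distinct-∷ _ _
      (distinct-∷ _ _ (distinct-map-inject₁ (Vec.map inject₁ β) (distinct-map-inject₁ β distinct))
                      (<⇒≢ ∘ tail-below-second))
      new-first

  prependMax₂-occ123 : Occ123 (prependMax₂ β) ⇔ Occ123 β
  prependMax₂-occ123 = mk⇔ restrict (embed-occ123 (prependMax₂-embedding β))
    where
    restrict : Occ123 v → Occ123 β
    restrict (occ123 (suc (suc i)) (suc (suc j)) (suc (suc l))
                     (s≤s (s≤s i<j)) (s≤s (s≤s j<l)) (s≤s (s≤s l<k)) x y) =
      occ123 i j l i<j j<l l<k (restrict-< x) (restrict-< y)
    restrict (occ123 zero       j l i<j j<l l<n x y) =
      ⊥-elim (head-on-top z<s (2≤third i<j j<l) l<n (<-trans x y))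
    restrict (occ123 (suc zero) j l i<j j<l l<n x y) =
      ⊥-elim (head-on-top (s<s z<s) (2≤third i<j j<l) l<n (<-trans x y))

  prependMax₂-occ132 : Occ132 (prependMax₂ β) ⇔ Occ132 β
  prependMax₂-occ132 = mk⇔ restrict (embed-occ132 (prependMax₂-embedding β))
    where
    restrict : Occ132 v → Occ132 β
    restrict (occ132 (suc (suc i)) (suc (suc j)) (suc (suc l))
                     (s≤s (s≤s i<j)) (s≤s (s≤s j<l)) (s≤s (s≤s l<k)) x y) =
      occ132 i j l i<j j<l l<k (restrict-< x) (restrict-< y)
    restrict (occ132 zero       j l i<j j<l l<n x _) =
      ⊥-elim (head-on-top z<s (2≤third i<j j<l) l<n x)
    restrict (occ132 (suc zero) j l i<j j<l l<n x _) =
      ⊥-elim (head-on-top (s<s z<s) (2≤third i<j j<l) l<n x)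

  prependMax₂-occ2341∨3241 : Occ2341∨3241 (prependMax₂ β) ⇔ Occ2341∨3241 β
  prependMax₂-occ2341∨3241 = mk⇔ restrict (embed-occ2341∨3241 (prependMax₂-embedding β))
    where
    restrict : Occ2341∨3241 v → Occ2341∨3241 β
    restrict (occ2341∨3241 (suc (suc i)) (suc (suc j)) (suc (suc l)) (suc (suc o))
                           (s≤s (s≤s i<j)) (s≤s (s≤s j<l)) (s≤s (s≤s l<o)) (s≤s (s≤s o<k)) x y z t) =
      occ2341∨3241 i j l o i<j j<l l<o o<k (restrict-< x) (restrict-< y) (restrict-< z) (restrict-< t)
    restrict (occ2341∨3241 zero       j l o i<j j<l l<o o<n _ _ z _) =
      ⊥-elim (head-on-top z<s (2≤third i<j j<l) (<-trans l<o o<n) z)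
    restrict (occ2341∨3241 (suc zero) j l o i<j j<l l<o o<n _ _ z _) =
      ⊥-elim (head-on-top (s<s z<s) (2≤third i<j j<l) (<-trans l<o o<n) z)

  prependMax₂-occ312 : Occ312 (prependMax₂ β) ⇔ Occ12 β
  prependMax₂-occ312 =
    mk⇔ restrict (extend-occ312 (prependMax₂-embedding β) (λ _ → z<s) tail-below-first)
    where
    restrict : Occ312 v → Occ12 β
    restrict (occ312 i (suc (suc j)) (suc (suc l)) _ (s≤s (s≤s j<l)) (s≤s (s≤s l<k)) x _) =
      occ12 j l j<l l<k (restrict-< x)
    restrict (occ312 _ (suc zero) l _ j<l l<n x _) = ⊥-elim (head-on-top (s<s z<s) j<l l<n x)

  prependMax₂-occ4123 : Occ4123 (prependMax₂ β) ⇔ Occ123 β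
  prependMax₂-occ4123 =
    mk⇔ restrict (extend-occ4123 (prependMax₂-embedding β) (λ _ → z<s) tail-below-first)
    where
    restrict : Occ4123 v → Occ123 β
    restrict (occ4123 i (suc (suc j)) (suc (suc l)) (suc (suc o)) _
                      (s≤s (s≤s j<l)) (s≤s (s≤s l<o)) (s≤s (s≤s o<k)) x y _) =
      occ123 j l o j<l l<o o<k (restrict-< x) (restrict-< y)
    restrict (occ4123 _ (suc zero) l o _ j<l l<o o<n x _ _) =
      ⊥-elim (head-on-top (s<s z<s) j<l (<-trans l<o o<n) x)

-- Where the maximum sits

TwoStack132 : ∀ {n} → Word n → Set
TwoStack132 v = Distinct v × ¬ Occ132 v × ¬ Occ2341∨3241 v

before-max-above-after : ∀ {m} (v : Word (suc m)) → Distinct v → ¬ Occ132 v →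
                         ∀ {p x y} → v ! p ≡ m → x < p → p < y → y < suc m → v ! y < v ! x
before-max-above-after v distinct no132 {p} {x} {y} vp≡m x<p p<y y<1+m
  with distinct-<⊎> v distinct (<-trans x<p (<-trans p<y y<1+m)) y<1+m (<⇒≢ (<-trans x<p p<y))
... | inj₂ vy<vx = vy<vx
... | inj₁ vx<vy = ⊥-elim (no132 (occ132 x p y x<p p<y y<1+m vx<vy vy<vp))
  where
  vy<vp : v ! y < v ! p
  vy<vp = subst (v ! y <_) (sym vp≡m)
    (below-max v distinct (<-trans p<y y<1+m) y<1+m vp≡m (≢-sym (<⇒≢ p<y)))

-- β is nonempty in the last two shapes because prependMax [] and prependMax₂ []
-- are also of the first shape.
data MaxShape : (m : ℕ) → Word (suc m) → Set where
  appended   : ∀ {m} (α : Word m) → MaxShape m (appendMax α)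
  prepended  : ∀ {k} (β : Word (suc k)) → MaxShape (suc k) (prependMax β)
  prepended₂ : ∀ {k} (β : Word (suc k)) → MaxShape (suc (suc k)) (prependMax₂ β)

max-second⇒next-first : ∀ {k} (v : Word (3 + k)) → Distinct v → ¬ Occ132 v →
                        v ! 1 ≡ 2 + k → v ! 0 ≡ 1 + k
max-second⇒next-first {k} v distinct no132 v1≡max
  with distinct⇒surjective v distinct (m<n⇒m<1+n (n<1+n (suc k)))
... | zero , _ , v0≡1+k = v0≡1+k
... | suc zero , _ , v1≡1+k = ⊥-elim (1+n≢n (trans (sym v1≡max) v1≡1+k))
... | suc (suc q) , q<3+k , vq≡1+k = ⊥-elim (<⇒≱
  (subst (_< v ! 0) vq≡1+k (before-max-above-after v distinct no132 v1≡max z<s (s<s z<s) q<3+k))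
  (≤-pred (below-max v distinct (s<s z<s) z<s v1≡max (λ ()))))

max-inside : ∀ {m} (v : Word (suc m)) → TwoStack132 v → ∀ p → p < m → v ! p ≡ m → MaxShape m v
max-inside {suc k} v (distinct , _) zero _ v0≡max with max-first⇒prependMax v distinct v0≡max
... | β , refl = prepended β
max-inside {suc zero} v _ (suc _) (s≤s ())
max-inside {suc (suc k)} v (distinct , no132 , _) (suc zero) _ v1≡max
  with max-second⇒prependMax₂ v distinct (max-second⇒next-first v distinct no132 v1≡max) v1≡max
... | β , refl = prepended₂ β
max-inside {suc (suc k)} v (distinct , no132 , no2341∨3241) p@(suc (suc _)) p<m vp≡max =
  ⊥-elim (no2341∨3241 (occ2341∨3241 0 1 p m z<s (s<s z<s) p<m (n<1+n m)
    (before-max-above-after v distinct no132 vp≡max z<s p<m (n<1+n m))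
    (before-max-above-after v distinct no132 vp≡max (s<s z<s) p<m (n<1+n m))
    (below-max-entry z<s (λ ())) (below-max-entry (s<s z<s) (λ ()))))
  where
  m = suc (suc k)
  below-max-entry : ∀ {x} → x < suc m → x ≢ p → v ! x < v ! p
  below-max-entry x<1+m x≢p =
    subst (v ! _ <_) (sym vp≡max) (below-max v distinct (m<n⇒m<1+n p<m) x<1+m vp≡max x≢p)

shape : ∀ {m} (v : Word (suc m)) → TwoStack132 v → MaxShape m v
shape {m} v two-stack@(distinct , _) with distinct⇒surjective v distinct (n<1+n m)
... | p , p<1+m , vp≡max with m≤n⇒m<n∨m≡n (≤-pred p<1+m)
...   | inj₁ p<m  = max-inside v two-stack p p<m vp≡max
...   | inj₂ refl with max-last⇒appendMax v distinct vp≡max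
...     | α , refl = appended α

appendMax-TwoStack132 : ∀ {m} (α : Word m) → TwoStack132 (appendMax α) ⇔ TwoStack132 α
appendMax-TwoStack132 α =
  appendMax-distinct α ×-⇔ ¬-cong-⇔ (appendMax-occ132 α) ×-⇔ ¬-cong-⇔ (appendMax-occ2341∨3241 α)

prependMax-TwoStack132 : ∀ {m} (β : Word m) → TwoStack132 (prependMax β) ⇔ TwoStack132 β
prependMax-TwoStack132 β =
  prependMax-distinct β ×-⇔ ¬-cong-⇔ (prependMax-occ132 β) ×-⇔ ¬-cong-⇔ (prependMax-occ2341∨3241 β)

prependMax₂-TwoStack132 : ∀ {k} (β : Word k) → TwoStack132 (prependMax₂ β) ⇔ TwoStack132 β
prependMax₂-TwoStack132 β = prependMax₂-distinct β
  ×-⇔ ¬-cong-⇔ (prependMax₂-occ132 β) ×-⇔ ¬-cong-⇔ (prependMax₂-occ2341∨3241 β)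

decreasing-distinct : ∀ m → Distinct (decreasing m)
decreasing-distinct zero    ()
decreasing-distinct (suc m) = from (prependMax-distinct (decreasing m)) (decreasing-distinct m)

decreasing-avoids12 : ∀ m → ¬ Occ12 (decreasing m)
decreasing-avoids12 zero    (occ12 _ _ _ () _)
decreasing-avoids12 (suc m) = decreasing-avoids12 m ∘ to (prependMax-occ12 (decreasing m))

avoids12⇒decreasing : ∀ {m} (α : Word m) → Distinct α → ¬ Occ12 α → α ≡ decreasing m
avoids12⇒decreasing [] _ _ = refl
avoids12⇒decreasing {suc m} α distinct no12 with distinct⇒surjective α distinct (n<1+n m)
... | zero , _ , α0≡max with max-first⇒prependMax α distinct α0≡max
...   | β , refl = cong prependMax
  (avoids12⇒decreasing β (to (prependMax-distinct β) distinct) (no12 ∘ from (prependMax-occ12 β)))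
avoids12⇒decreasing {suc m} α distinct no12 | suc p , p<1+m , αp≡max =
  ⊥-elim (no12 (occ12 0 (suc p) z<s p<1+m
    (subst (α ! 0 <_) (sym αp≡max) (below-max α distinct p<1+m z<s αp≡max (λ ())))))

IsDecreasing : ∀ {n} → Word n → Set
IsDecreasing {n} v = v ≡ decreasing n

TwoStack132∧avoids12⇔decreasing : ∀ {m} (α : Word m) → (TwoStack132 α × ¬ Occ12 α) ⇔ IsDecreasing α
TwoStack132∧avoids12⇔decreasing {m} α = mk⇔
  (λ ((distinct , _) , no12) → avoids12⇒decreasing α distinct no12)
  (λ { refl → (decreasing-distinct m , decreasing-avoids12 m ∘ occ132⇒occ12 ,
                decreasing-avoids12 m ∘ occ2341∨3241⇒occ12) ,
              decreasing-avoids12 m })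

𝒫 : (∀ {n} → Word n → Set) → ∀ {n} → Word n → Set
𝒫 Occ v = TwoStack132 v × ¬ Occ v

𝒫⇔InP : ∀ {Occ : ∀ {n} → Word n → Set} {k} (τ : Word k) →
        (∀ {n} {v : Word n} → Occ v → Contains v τ) → (∀ {n} {v : Word n} → Contains v τ → Occ v) →
        ∀ {n} (v : Word n) → 𝒫 Occ v ⇔ InP τ v
𝒫⇔InP τ occ⇒contains contains⇒occ v = mk⇔
  (λ ((distinct , no132 , no2341∨3241) , no-occ) →
     from (isPerm⇔distinct v) distinct , no132 ∘ contains⇒occ132 ,
     no2341∨3241 ∘ contains2341⇒occ , no2341∨3241 ∘ contains3241⇒occ , no-occ ∘ contains⇒occ)
  (λ (perm , avoids132 , avoids2341 , avoids3241 , avoidsτ) →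
     let distinct = to (isPerm⇔distinct v) perm in
     (distinct , avoids132 ∘ occ132⇒contains ,
      [ avoids2341 , avoids3241 ]′ ∘ occ2341∨3241⇒contains distinct) ,
     avoidsτ ∘ occ⇒contains)

decreasing-𝒫 : ∀ {Occ : ∀ {n} → Word n → Set} → (∀ {n} {v : Word n} → Occ v → Occ12 v) →
               ∀ m → 𝒫 Occ (decreasing m)
decreasing-𝒫 occ⇒occ12 m with from (TwoStack132∧avoids12⇔decreasing (decreasing m)) refl
... | two-stack , no12 = two-stack , no12 ∘ occ⇒occ12

-- Counting

Image : ∀ {m n} → (Word m → Word n) → (Word m → Set) → Word n → Set
Image f S v = ∃ λ u → S u × f u ≡ v

images-disjoint : ∀ {m m′ n} {f : Word m → Word n} {g : Word m′ → Word n} {S T} →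
                  (∀ u u′ → f u ≢ g u′) → ∀ {v} → Image f S v → Image g T v → ⊥
images-disjoint f≢g (u , _ , refl) (u′ , _ , eq) = f≢g u u′ (sym eq)

hasCard-⇔ : ∀ {n} {S T : Word n → Set} {a} → (∀ v → S v ⇔ T v) → HasCard S a → HasCard T a
hasCard-⇔ S⇔T (xs , length≡ , unique , ∈⇔S) = xs , length≡ , unique , λ v → S⇔T v ⇔-∘ ∈⇔S v

hasCard-∸ : ∀ {n} {S : Word n → Set} {a b c} → a + b ≡ c → HasCard S a → HasCard S (c ∸ b)
hasCard-∸ {S = S} {a} {b} a+b≡c = subst (HasCard S) (trans (sym (m+n∸n≡m a b)) (cong (_∸ b) a+b≡c))

hasCard-singleton : ∀ {n} (x : Word n) → HasCard (_≡ x) 1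
hasCard-singleton x = x List.∷ List.[] , refl , All.[] AllPairs.∷ AllPairs.[] ,
  λ v → mk⇔ (λ { (here v≡x) → v≡x ; (there ()) }) here

hasCard-length0 : ∀ {S : Word 0 → Set} → S [] → HasCard S 1
hasCard-length0 S[] = hasCard-⇔ (λ { [] → mk⇔ (λ { refl → S[] }) (λ _ → refl) }) (hasCard-singleton [])

hasCard-image : ∀ {m n} {f : Word m → Word n} {S a} → (∀ {u u′} → f u ≡ f u′ → u ≡ u′) →
                HasCard S a → HasCard (Image f S) a
hasCard-image {f = f} {S} f-injective (xs , length≡ , unique , ∈⇔S) =
  List.map f xs , trans (length-map f xs) length≡ , Uniqueₚ.map⁺ f-injective unique ,
  λ v → mk⇔ (∈⇒image v) image⇒∈
  where
  ∈⇒image : ∀ v → v ∈ List.map f xs → Image f S v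
  ∈⇒image v v∈ with ∈-map⁻ f v∈
  ... | u , u∈xs , refl = u , to (∈⇔S u) u∈xs , refl
  image⇒∈ : ∀ {v} → Image f S v → v ∈ List.map f xs
  image⇒∈ (u , Su , refl) = ∈-map⁺ f (from (∈⇔S u) Su)

hasCard-⊎ : ∀ {n} {S T : Word n → Set} {a b} → (∀ {v} → S v → T v → ⊥) →
            HasCard S a → HasCard T b → HasCard (λ v → S v ⊎ T v) (a + b)
hasCard-⊎ disjoint (xs , length-xs , unique-xs , ∈xs⇔S) (ys , length-ys , unique-ys , ∈ys⇔T) =
  xs ++ ys , trans (length-++ xs) (cong₂ _+_ length-xs length-ys) ,
  Uniqueₚ.++⁺ unique-xs unique-ys
    (λ (v∈xs , v∈ys) → disjoint (to (∈xs⇔S _) v∈xs) (to (∈ys⇔T _) v∈ys)) ,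
  λ v → mk⇔ (Sum.map (to (∈xs⇔S v)) (to (∈ys⇔T v)) ∘ ∈-++⁻ xs)
            [ ∈-++⁺ˡ ∘ from (∈xs⇔S v) , ∈-++⁺ʳ xs ∘ from (∈ys⇔T v) ]′

module Counting
  (C Cs Cc : ∀ {n} → Word n → Set)
  (C-appendMax   : ∀ {m} (α : Word m) → C (appendMax α) ⇔ Cs α)
  (C-prependMax  : ∀ {m} (β : Word m) → C (prependMax β) ⇔ Cc β)
  (C-prependMax₂ : ∀ {k} (β : Word k) → C (prependMax₂ β) ⇔ Cc β)
  (C⇒TwoStack132 : ∀ {n} {v : Word n} → C v → TwoStack132 v)
  where

  private
    appended-in-C : ∀ {m} {v : Word (suc m)} → Image appendMax Cs v → C v
    appended-in-C (α , Csα , refl) = from (C-appendMax α) Csα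

    prepended-in-C : ∀ {m} {v : Word (suc m)} → Image prependMax Cc v → C v
    prepended-in-C (β , Ccβ , refl) = from (C-prependMax β) Ccβ

    prepended₂-in-C : ∀ {k} {v : Word (suc (suc k))} → Image prependMax₂ Cc v → C v
    prepended₂-in-C (β , Ccβ , refl) = from (C-prependMax₂ β) Ccβ

  hasCard-length1 : ∀ {a} → HasCard (Cs {0}) a → HasCard (C {1}) a
  hasCard-length1 =
    hasCard-⇔ (λ v → mk⇔ appended-in-C (decompose v)) ∘ hasCard-image appendMax-injective
    where
    decompose : ∀ v → C v → Image appendMax Cs v
    decompose v Cv with shape v (C⇒TwoStack132 Cv)
    ... | appended α = α , to (C-appendMax α) Cv , refl

  hasCard-length2 : ∀ {a b} → HasCard (Cs {1}) a → HasCard (Cc {1}) b → HasCard (C {2}) (a + b)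
  hasCard-length2 Cs-card Cc-card =
    hasCard-⇔ (λ v → mk⇔ [ appended-in-C , prepended-in-C ]′ (decompose v))
      (hasCard-⊎ (images-disjoint appendMax≢prependMax)
        (hasCard-image appendMax-injective Cs-card) (hasCard-image prependMax-injective Cc-card))
    where
    decompose : ∀ v → C v → Image appendMax Cs v ⊎ Image prependMax Cc v
    decompose v Cv with shape v (C⇒TwoStack132 Cv)
    ... | appended α  = inj₁ (α , to (C-appendMax α) Cv , refl)
    ... | prepended β = inj₂ (β , to (C-prependMax β) Cv , refl)

  hasCard-length3+ : ∀ {k a b c} → HasCard (Cs {2 + k}) a → HasCard (Cc {2 + k}) b →
                     HasCard (Cc {1 + k}) c → HasCard (C {3 + k}) (a + (b + c))
  hasCard-length3+ Cs-card Cc-card Cc-card′ =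
    hasCard-⇔ (λ v → mk⇔ [ appended-in-C , [ prepended-in-C , prepended₂-in-C ]′ ]′ (decompose v))
      (hasCard-⊎ (λ app → [ images-disjoint appendMax≢prependMax app
                           , images-disjoint appendMax≢prependMax₂ app ]′)
        (hasCard-image appendMax-injective Cs-card)
        (hasCard-⊎ (images-disjoint prependMax≢prependMax₂)
          (hasCard-image prependMax-injective Cc-card) (hasCard-image prependMax₂-injective Cc-card′)))
    where
    decompose : ∀ v → C v → Image appendMax Cs v ⊎ Image prependMax Cc v ⊎ Image prependMax₂ Cc v
    decompose v Cv with shape v (C⇒TwoStack132 Cv)
    ... | appended α   = inj₁ (α , to (C-appendMax α) Cv , refl)
    ... | prepended β  = inj₂ (inj₁ (β , to (C-prependMax β) Cv , refl))
    ... | prepended₂ β = inj₂ (inj₂ (β , to (C-prependMax₂ β) Cv , refl))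

module Counting𝒫123 = Counting (𝒫 Occ123) IsDecreasing (𝒫 Occ123)
  (λ α → TwoStack132∧avoids12⇔decreasing α
           ⇔-∘ (appendMax-TwoStack132 α ×-⇔ ¬-cong-⇔ (appendMax-occ123 α)))
  (λ β → prependMax-TwoStack132 β ×-⇔ ¬-cong-⇔ (prependMax-occ123 β))
  (λ β → prependMax₂-TwoStack132 β ×-⇔ ¬-cong-⇔ (prependMax₂-occ123 β))
  proj₁

module Counting𝒫312 = Counting (𝒫 Occ312) (𝒫 Occ312) IsDecreasing
  (λ α → appendMax-TwoStack132 α ×-⇔ ¬-cong-⇔ (appendMax-occ312 α))
  (λ β → TwoStack132∧avoids12⇔decreasing β
           ⇔-∘ (prependMax-TwoStack132 β ×-⇔ ¬-cong-⇔ (prependMax-occ312 β)))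
  (λ β → TwoStack132∧avoids12⇔decreasing β
           ⇔-∘ (prependMax₂-TwoStack132 β ×-⇔ ¬-cong-⇔ (prependMax₂-occ312 β)))
  proj₁

module Counting𝒫4123 = Counting (𝒫 Occ4123) (𝒫 Occ4123) (𝒫 Occ123)
  (λ α → appendMax-TwoStack132 α ×-⇔ ¬-cong-⇔ (appendMax-occ4123 α))
  (λ β → prependMax-TwoStack132 β ×-⇔ ¬-cong-⇔ (prependMax-occ4123 β))
  (λ β → prependMax₂-TwoStack132 β ×-⇔ ¬-cong-⇔ (prependMax₂-occ4123 β))
  proj₁

#𝒫123 : ℕ → ℕ
#𝒫123 zero                = 1
#𝒫123 (suc zero)          = 1
#𝒫123 (suc (suc zero))    = 1 + #𝒫123 1
#𝒫123 (suc (suc (suc k))) = 1 + (#𝒫123 (suc (suc k)) + #𝒫123 (suc k))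

#𝒫312 : ℕ → ℕ
#𝒫312 zero                = 1
#𝒫312 (suc zero)          = #𝒫312 0
#𝒫312 (suc (suc zero))    = #𝒫312 1 + 1
#𝒫312 (suc (suc (suc k))) = #𝒫312 (suc (suc k)) + (1 + 1)

#𝒫4123 : ℕ → ℕ
#𝒫4123 zero                = 1
#𝒫4123 (suc zero)          = #𝒫4123 0
#𝒫4123 (suc (suc zero))    = #𝒫4123 1 + #𝒫123 1
#𝒫4123 (suc (suc (suc k))) = #𝒫4123 (suc (suc k)) + (#𝒫123 (suc (suc k)) + #𝒫123 (suc k))

hasCard-𝒫123 : ∀ n → HasCard {n} (𝒫 Occ123) (#𝒫123 n)
hasCard-𝒫123 zero                = hasCard-length0 (decreasing-𝒫 occ123⇒occ12 0)
hasCard-𝒫123 (suc zero)          = Counting𝒫123.hasCard-length1 (hasCard-singleton [])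
hasCard-𝒫123 (suc (suc zero))    =
  Counting𝒫123.hasCard-length2 (hasCard-singleton _) (hasCard-𝒫123 1)
hasCard-𝒫123 (suc (suc (suc k))) =
  Counting𝒫123.hasCard-length3+ (hasCard-singleton _) (hasCard-𝒫123 (suc (suc k))) (hasCard-𝒫123 (suc k))

hasCard-𝒫312 : ∀ n → HasCard {n} (𝒫 Occ312) (#𝒫312 n)
hasCard-𝒫312 zero                = hasCard-length0 (decreasing-𝒫 occ312⇒occ12 0)
hasCard-𝒫312 (suc zero)          = Counting𝒫312.hasCard-length1 (hasCard-𝒫312 0)
hasCard-𝒫312 (suc (suc zero))    =
  Counting𝒫312.hasCard-length2 (hasCard-𝒫312 1) (hasCard-singleton _)
hasCard-𝒫312 (suc (suc (suc k))) =
  Counting𝒫312.hasCard-length3+ (hasCard-𝒫312 (suc (suc k))) (hasCard-singleton _) (hasCard-singleton _)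

hasCard-𝒫4123 : ∀ n → HasCard {n} (𝒫 Occ4123) (#𝒫4123 n)
hasCard-𝒫4123 zero                = hasCard-length0 (decreasing-𝒫 (occ123⇒occ12 ∘ occ4123⇒occ123) 0)
hasCard-𝒫4123 (suc zero)          = Counting𝒫4123.hasCard-length1 (hasCard-𝒫4123 0)
hasCard-𝒫4123 (suc (suc zero))    =
  Counting𝒫4123.hasCard-length2 (hasCard-𝒫4123 1) (hasCard-𝒫123 1)
hasCard-𝒫4123 (suc (suc (suc k))) = Counting𝒫4123.hasCard-length3+
  (hasCard-𝒫4123 (suc (suc k))) (hasCard-𝒫123 (suc (suc k))) (hasCard-𝒫123 (suc k))

#𝒫123-fib : ∀ n → #𝒫123 (suc n) + 1 ≡ fib (3 + n)
#𝒫123-fib zero          = refl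
#𝒫123-fib (suc zero)    = refl
#𝒫123-fib (suc (suc n)) = begin
  1 + (a + b) + 1    ≡⟨ rearrange a b ⟩
  (a + 1) + (b + 1)  ≡⟨ cong₂ _+_ (#𝒫123-fib (suc n)) (#𝒫123-fib n) ⟩
  fib (5 + n)        ∎
  where
  open ≡-Reasoning
  a = #𝒫123 (2 + n)
  b = #𝒫123 (1 + n)
  rearrange : ∀ a b → 1 + (a + b) + 1 ≡ (a + 1) + (b + 1)
  rearrange = solve-∀

#𝒫312-linear : ∀ n → #𝒫312 (2 + n) + 2 ≡ 2 * (2 + n)
#𝒫312-linear zero    = refl
#𝒫312-linear (suc n) = begin
  p + (1 + 1) + 2  ≡⟨ rearrange p ⟩
  p + 2 + 2        ≡⟨ cong (_+ 2) (#𝒫312-linear n) ⟩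
  2 * (2 + n) + 2  ≡⟨ double n ⟩
  2 * (3 + n)      ∎
  where
  open ≡-Reasoning
  p = #𝒫312 (2 + n)
  rearrange : ∀ p → p + (1 + 1) + 2 ≡ p + 2 + 2
  rearrange = solve-∀
  double : ∀ n → 2 * (2 + n) + 2 ≡ 2 * (3 + n)
  double = solve-∀

#𝒫4123-fib : ∀ n → #𝒫4123 n + (2 * n + 2) ≡ fib (4 + n)
#𝒫4123-fib zero                = refl
#𝒫4123-fib (suc zero)          = refl
#𝒫4123-fib (suc (suc zero))    = refl
#𝒫4123-fib (suc (suc (suc n))) = begin
  p + (a + b) + (2 * (3 + n) + 2)                ≡⟨ rearrange p a b n ⟩
  (p + (2 * (2 + n) + 2)) + ((a + 1) + (b + 1))  ≡⟨ cong₂ _+_ (#𝒫4123-fib (suc (suc n)))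
                                                      (cong₂ _+_ (#𝒫123-fib (suc n)) (#𝒫123-fib n)) ⟩
  fib (7 + n)                                    ∎
  where
  open ≡-Reasoning
  p = #𝒫4123 (2 + n)
  a = #𝒫123 (2 + n)
  b = #𝒫123 (1 + n)
  rearrange : ∀ p a b n →
              p + (a + b) + (2 * (3 + n) + 2) ≡ (p + (2 * (2 + n) + 2)) + ((a + 1) + (b + 1))
  rearrange = solve-∀

mainTheorem6 : ((n : ℕ) → 2 ≤ n → HasCard {n} (InP p312) (2 * n ∸ 2))
    × ((n : ℕ) → HasCard {n} (InP p4123) (fib (n + 4) ∸ (2 * n + 2)))
mainTheorem6 = count312 , count4123
  where
  count312 : (n : ℕ) → 2 ≤ n → HasCard {n} (InP p312) (2 * n ∸ 2)
  count312 (suc zero) (s≤s ())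
  count312 (suc (suc n)) _ =
    hasCard-⇔ (𝒫⇔InP {Occ312} p312 occ312⇒contains contains⇒occ312)
      (hasCard-∸ (#𝒫312-linear n) (hasCard-𝒫312 (2 + n)))

  count4123 : (n : ℕ) → HasCard {n} (InP p4123) (fib (n + 4) ∸ (2 * n + 2))
  count4123 n =
    hasCard-⇔ (𝒫⇔InP {Occ4123} p4123 occ4123⇒contains contains⇒occ4123)
      (hasCard-∸ (trans (#𝒫4123-fib n) (cong fib (+-comm 4 n))) (hasCard-𝒫4123 n))
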